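{- Let $G=(P,E)$ be a grid graph with $|P|=n$ vertices and $|E|=m$ edges, whose vertices are labelled $p_1,\dots,p_n$ and whose edges are labelled bijectively by $\{1,\dots,m\}$. Let $Q=\{q_1,\dots,q_n\}\subset\mathbb{R}^4$ be the set of constructed points (as defined in the context). Then $Q$ is in relaxed general position, i.e. no three points of $Q$ share the value of any coordinate, and any two points of $Q$ share the value of at most one coordinate.
   Context: A grid graph $G=(P,E)$ consists of a finite set $P$ of points in $\mathbb{R}^2$ with integer coordinates, where two points $p_i=(x_i,y_i)$ and $p_k=(x_k,y_k)$ are adjacent (joined by an edge) if and only if either $x_i=x_k$ and $y_i=y_k\pm 1$, or $y_i=y_k$ and $x_i=x_k\pm1$. Construction: denote the coordinates of $\mathbb{R}^4$ by $(a,b,c,d)$. For each $p_i=(x_i,y_i)\in P$, the constructed point $q_i=(a_i,b_i,c_i,d_i)$ is defined by first setting $a_i=b_i=c_i=d_i=i$, and then, for every neighbour $p_k=(x_k,y_k)$ of $p_i$, with $j$ the label of the edge $\{p_i,p_k\}$, updating as follows: if $y_k=y_i$ and either ($x_i$ odd and $x_k=x_i-1$) or ($x_i$ even and $x_k=x_i+1$), set $a_i=n+j$; if $y_k=y_i$ and either ($x_i$ odd and $x_k=x_i+1$) or ($x_i$ even and $x_k=x_i-1$), set $b_i=n+j$; if $x_k=x_i$ and either ($y_i$ odd and $y_k=y_i-1$) or ($y_i$ even and $y_k=y_i+1$), set $c_i=n+j$; if $x_k=x_i$ and either ($y_i$ odd and $y_k=y_i+1$) or ($y_i$ even and $y_k=y_i-1$),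 set $d_i=n+j$. A set of points in $\mathbb{R}^d$ is in relaxed general position if no three of the points share any coordinate and any two of the points share at most one coordinate. -}

module Defs where

open import Data.Bool using (Bool; true; false; _∧_; _∨_; not; if_then_else_)
open import Data.Nat as ℕ using (ℕ; _%_; _≡ᵇ_)
open import Data.Integer as ℤ using (ℤ; ∣_∣; 1ℤ)
open import Data.Fin as Fin using (Fin; toℕ; zero; suc)
open import Data.List using (List; allFin; foldl)
open import Data.Maybe using (Maybe; just; nothing)
open import Data.Product using (_×_; _,_; proj₁; proj₂; Σ; ∃)
open import Data.Sum using (_⊎_)
open import Relation.Nullary using (¬_; does)
open import Relation.Binary.PropositionalEquality using (_≡_; _≢_)

Point : Set
Point = ℤ × ℤ

Adj : Point → Point → Set
Adj (xi , yi) (xk , yk) =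
  (xi ≡ xk × (yi ≡ yk ℤ.+ 1ℤ ⊎ yi ≡ yk ℤ.- 1ℤ)) ⊎
  (yi ≡ yk × (xi ≡ xk ℤ.+ 1ℤ ⊎ xi ≡ xk ℤ.- 1ℤ))

-- An edge labelling: edge with label (toℕ j + 1) joins the points with
-- indices proj₁ (e j) and proj₂ (e j).
SameEdge : {n : ℕ} → Fin n × Fin n → Fin n × Fin n → Set
SameEdge (u , v) (u' , v') = (u ≡ u' × v ≡ v') ⊎ (u ≡ v' × v ≡ u')

IsEdgeLabelling : (n m : ℕ) → (Fin n → Point) → (Fin m → Fin n × Fin n) → Set
IsEdgeLabelling n m p e =
  ((j : Fin m) → Adj (p (proj₁ (e j))) (p (proj₂ (e j)))) ×
  ((u v : Fin n) → Adj (p u) (p v) → ∃ λ j → SameEdge (e j) (u , v)) ×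
  ((j j' : Fin m) → SameEdge (e j) (e j') → j ≡ j')

_==ℤ_ : ℤ → ℤ → Bool
a ==ℤ b = does (a ℤ.≟ b)

_==F_ : {n : ℕ} → Fin n → Fin n → Bool
a ==F b = does (a Fin.≟ b)

isOdd : ℤ → Bool
isOdd x = (∣ x ∣ % 2) ≡ᵇ 1

-- Points of ℝ⁴ with coordinates (a,b,c,d), indexed by Fin 4
-- (zero = a, 1 = b, 2 = c, 3 = d).  All constructed coordinates are natural
-- numbers.
Point4 : Set
Point4 = Fin 4 → ℕ

set : Point4 → Fin 4 → ℕ → Point4
set q c v c' = if c' ==F c then v else q c'

other : {n : ℕ} → Fin n → Fin n × Fin n → Maybe (Fin n)
other i (u , v) = if u ==F i then just v else (if v ==F i then just u else nothing)

module Construction (n m : ℕ) (p : Fin n → Point) (e : Fin m → Fin n × Fin n) where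

  updateBy : Fin n → Fin n → ℕ → Point4 → Point4
  updateBy i k lbl q =
    let xi = proj₁ (p i) ; yi = proj₂ (p i)
        xk = proj₁ (p k) ; yk = proj₂ (p k)
        oxi = isOdd xi ; oyi = isOdd yi
        v = n ℕ.+ lbl
        q1 = if (yk ==ℤ yi) ∧ ((oxi ∧ (xk ==ℤ (xi ℤ.- 1ℤ))) ∨ (not oxi ∧ (xk ==ℤ (xi ℤ.+ 1ℤ))))
               then set q zero v else q
        q2 = if (yk ==ℤ yi) ∧ ((oxi ∧ (xk ==ℤ (xi ℤ.+ 1ℤ))) ∨ (not oxi ∧ (xk ==ℤ (xi ℤ.- 1ℤ))))
               then set q1 (suc zero) v else q1
        q3 = if (xk ==ℤ xi) ∧ ((oyi ∧ (yk ==ℤ (yi ℤ.- 1ℤ))) ∨ (not oyi ∧ (yk ==ℤ (yi ℤ.+ 1ℤ))))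
               then set q2 (suc (suc zero)) v else q2
        q4 = if (xk ==ℤ xi) ∧ ((oyi ∧ (yk ==ℤ (yi ℤ.+ 1ℤ))) ∨ (not oyi ∧ (yk ==ℤ (yi ℤ.- 1ℤ))))
               then set q3 (suc (suc (suc zero))) v else q3
    in q4

  step : Fin n → Point4 → Fin m → Point4
  step i q j with other i (e j)
  ... | just k  = updateBy i k (ℕ.suc (toℕ j)) q
  ... | nothing = q

  -- q_i: start with all coordinates equal to the label i (= toℕ i + 1), then
  -- update for every neighbour (each neighbour is reached through its unique edge)
  q : Fin n → Point4
  q i = foldl (step i) (λ _ → ℕ.suc (toℕ i)) (allFin m)

RelaxedGeneralPosition : {n d : ℕ} → (Fin n → Fin d → ℕ) → Set
RelaxedGeneralPosition {n} {d} q =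
  ((i j k : Fin n) → i ≢ j → j ≢ k → i ≢ k → (c : Fin d) →
     ¬ (q i c ≡ q j c × q j c ≡ q k c)) ×
  ((i j : Fin n) → i ≢ j → (c c' : Fin d) →
     q i c ≡ q j c → q i c' ≡ q j c' → c ≡ c')

module Submission where

-- Every coordinate of a constructed point q_i is either the vertex label
-- i + 1 ≤ n, or the value n + j of an edge j incident to p_i.  Vertex labels
-- and edge values are pairwise different, so two distinct points can share a
-- coordinate value only through an edge j joining them, and then no third
-- point can carry the same value.  Moreover, an edge from p_i writes into
-- coordinate c only when its other end is the "c-partner" of p_i, one of four
-- pairwise different lattice neighbours of p_i; hence two points share at most
-- one coordinate.
--
-- The argument never
-- needs injectivity of p or that e is a labelling of all grid edges.

open import Defs
open import Data.Nat using (ℕ)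
open import Data.Fin using (Fin)
open import Data.Product using (_×_)
open import Function.Definitions using (Injective)
open import Relation.Binary.PropositionalEquality using (_≡_)

open import Data.Bool using (Bool; true; false; T; _∧_; _∨_; not; if_then_else_)
open import Data.Nat as ℕ using (suc)
open import Data.Nat.Properties as ℕP using ()
open import Data.Integer as ℤ using (ℤ; 1ℤ; _<_; -<+; +<+)
open import Data.Integer.Properties as ℤP using ()
open import Data.Fin as Fin using (toℕ; zero; suc)
open import Data.Fin.Properties using (toℕ-injective; toℕ<n)
open import Data.List using (List; []; _∷_; foldl; allFin)
open import Data.Maybe using (just; nothing)
open import Data.Maybe.Properties using (just-injective)
open import Data.Product using (_,_; proj₁; proj₂; Σ-syntax)
open import Data.Product.Properties using (×-≡,≡→≡)
open import Data.Sum using (_⊎_; inj₁; inj₂)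
open import Data.Empty using (⊥-elim)
open import Relation.Nullary using (¬_; yes; no)
open import Relation.Binary.PropositionalEquality using (refl; sym; trans; cong; subst; _≢_; ≢-sym)

foldl-preserves : ∀ {a b} {A : Set a} {B : Set b} (P : A → Set) {f : A → B → A} →
  (∀ x y → P x → P (f x y)) → (ys : List B) {x : A} → P x → P (foldl f x ys)
foldl-preserves P step []       px = px
foldl-preserves P step (y ∷ ys) px = foldl-preserves P step ys (step _ y px)

module _ (x : ℤ) where

  pred<self : x ℤ.- 1ℤ < x
  pred<self = subst (x ℤ.- 1ℤ <_) (ℤP.+-identityʳ x) (ℤP.+-monoʳ-< x -<+)

  self<suc : x < x ℤ.+ 1ℤ
  self<suc = subst (_< x ℤ.+ 1ℤ) (ℤP.+-identityʳ x) (ℤP.+-monoʳ-< x (+<+ ℕ.z<s))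

  pred≢suc : x ℤ.- 1ℤ ≢ x ℤ.+ 1ℤ
  pred≢suc = ℤP.<⇒≢ (ℤP.<-trans pred<self self<suc)

-- Along one axis, the construction pairs x with x - 1 when x is odd and with
-- x + 1 when x is even ('near'); the opposite neighbour is 'far'.
near : Bool → ℤ → ℤ
near odd x = if odd then x ℤ.- 1ℤ else x ℤ.+ 1ℤ

far : Bool → ℤ → ℤ
far odd x = if odd then x ℤ.+ 1ℤ else x ℤ.- 1ℤ

near≢self : ∀ odd x → near odd x ≢ x
near≢self true  x = ℤP.<⇒≢ (pred<self x)
near≢self false x = ≢-sym (ℤP.<⇒≢ (self<suc x))

far≢self : ∀ odd x → far odd x ≢ x
far≢self true  x = ≢-sym (ℤP.<⇒≢ (self<suc x))
far≢self false x = ℤP.<⇒≢ (pred<self x)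

near≢far : ∀ odd x → near odd x ≢ far odd x
near≢far true  x = pred≢suc x
near≢far false x = ≢-sym (pred≢suc x)

-- The c-partner of a lattice point: the neighbour whose edge the construction
-- records in coordinate c (a, b: horizontal neighbours; c, d: vertical ones).
partner : Fin 4 → Point → Point
partner zero                   (x , y) = near (isOdd x) x , y
partner (suc zero)             (x , y) = far (isOdd x) x , y
partner (suc (suc zero))       (x , y) = x , near (isOdd y) y
partner (suc (suc (suc zero))) (x , y) = x , far (isOdd y) y

partner-injective : ∀ v c c' → partner c v ≡ partner c' v → c ≡ c'
partner-injective (x , y) = distinct
  where
  ox = isOdd x ; oy = isOdd y
  distinct : ∀ c c' → partner c (x , y) ≡ partner c' (x , y) → c ≡ c'
  distinct zero                   zero                   _  = refl
  distinct (suc zero)             (suc zero)             _  = refl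
  distinct (suc (suc zero))       (suc (suc zero))       _  = refl
  distinct (suc (suc (suc zero))) (suc (suc (suc zero))) _  = refl
  distinct zero                   (suc zero)             eq = ⊥-elim (near≢far ox x (cong proj₁ eq))
  distinct (suc zero)             zero                   eq = ⊥-elim (near≢far ox x (sym (cong proj₁ eq)))
  distinct (suc (suc zero))       (suc (suc (suc zero))) eq = ⊥-elim (near≢far oy y (cong proj₂ eq))
  distinct (suc (suc (suc zero))) (suc (suc zero))       eq = ⊥-elim (near≢far oy y (sym (cong proj₂ eq)))
  distinct zero                   (suc (suc zero))       eq = ⊥-elim (near≢self ox x (cong proj₁ eq))
  distinct zero                   (suc (suc (suc zero))) eq = ⊥-elim (near≢self ox x (cong proj₁ eq))
  distinct (suc zero)             (suc (suc zero))       eq = ⊥-elim (far≢self ox x (cong proj₁ eq))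
  distinct (suc zero)             (suc (suc (suc zero))) eq = ⊥-elim (far≢self ox x (cong proj₁ eq))
  distinct (suc (suc zero))       zero                   eq = ⊥-elim (near≢self ox x (sym (cong proj₁ eq)))
  distinct (suc (suc zero))       (suc zero)             eq = ⊥-elim (far≢self ox x (sym (cong proj₁ eq)))
  distinct (suc (suc (suc zero))) zero                   eq = ⊥-elim (near≢self ox x (sym (cong proj₁ eq)))
  distinct (suc (suc (suc zero))) (suc zero)             eq = ⊥-elim (far≢self ox x (sym (cong proj₁ eq)))

-- The shape of the four tests in 'updateBy': the other coordinate agrees, and
-- the moving coordinate takes the value selected by the parity flag.
onAxis : (same odd ifOdd ifEven : Bool) → Bool
onAxis same odd ifOdd ifEven = same ∧ ((odd ∧ ifOdd) ∨ (not odd ∧ ifEven))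

onAxis-true : ∀ same odd ifOdd ifEven →
  T (onAxis same odd ifOdd ifEven) → T same × T (if odd then ifOdd else ifEven)
onAxis-true true true  true  _    _ = _ , _
onAxis-true true false _     true _ = _ , _
onAxis-true true true  false _    ()
onAxis-true true false _     false ()
onAxis-true false _    _     _    ()

==ℤ-sound : ∀ {a b} → T (a ==ℤ b) → a ≡ b
==ℤ-sound {a} {b} h with a ℤ.≟ b
... | yes a≡b = a≡b
... | no  _   = ⊥-elim h

onAxis-sound : ∀ {a a' b' : ℤ} odd s t →
  T (onAxis (a' ==ℤ a) odd (b' ==ℤ s) (b' ==ℤ t)) → a' ≡ a × b' ≡ (if odd then s else t)
onAxis-sound {a} {a'} {b'} true s t h with onAxis-true (a' ==ℤ a) true (b' ==ℤ s) (b' ==ℤ t) h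
... | same , moved = ==ℤ-sound same , ==ℤ-sound moved
onAxis-sound {a} {a'} {b'} false s t h with onAxis-true (a' ==ℤ a) false (b' ==ℤ s) (b' ==ℤ t) h
... | same , moved = ==ℤ-sound same , ==ℤ-sound moved

guard : Point → Point → Fin 4 → Bool
guard (xi , yi) (xk , yk) zero =
  onAxis (yk ==ℤ yi) (isOdd xi) (xk ==ℤ (xi ℤ.- 1ℤ)) (xk ==ℤ (xi ℤ.+ 1ℤ))
guard (xi , yi) (xk , yk) (suc zero) =
  onAxis (yk ==ℤ yi) (isOdd xi) (xk ==ℤ (xi ℤ.+ 1ℤ)) (xk ==ℤ (xi ℤ.- 1ℤ))
guard (xi , yi) (xk , yk) (suc (suc zero)) =
  onAxis (xk ==ℤ xi) (isOdd yi) (yk ==ℤ (yi ℤ.- 1ℤ)) (yk ==ℤ (yi ℤ.+ 1ℤ))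
guard (xi , yi) (xk , yk) (suc (suc (suc zero))) =
  onAxis (xk ==ℤ xi) (isOdd yi) (yk ==ℤ (yi ℤ.+ 1ℤ)) (yk ==ℤ (yi ℤ.- 1ℤ))

guard-partner : ∀ c u v → T (guard u v c) → v ≡ partner c u
guard-partner zero (xi , yi) (xk , yk) g with onAxis-sound (isOdd xi) _ _ g
... | yk≡yi , xk≡near = ×-≡,≡→≡ (xk≡near , yk≡yi)
guard-partner (suc zero) (xi , yi) (xk , yk) g with onAxis-sound (isOdd xi) _ _ g
... | yk≡yi , xk≡far = ×-≡,≡→≡ (xk≡far , yk≡yi)
guard-partner (suc (suc zero)) (xi , yi) (xk , yk) g with onAxis-sound (isOdd yi) _ _ g
... | xk≡xi , yk≡near = ×-≡,≡→≡ (xk≡xi , yk≡near)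
guard-partner (suc (suc (suc zero))) (xi , yi) (xk , yk) g with onAxis-sound (isOdd yi) _ _ g
... | xk≡xi , yk≡far = ×-≡,≡→≡ (xk≡xi , yk≡far)

AllCoords : (ℕ → Fin 4 → Set) → Point4 → Set
AllCoords R q = ∀ c → R (q c) c

setIf : Bool → Fin 4 → ℕ → Point4 → Point4
setIf b c v q = if b then set q c v else q

setIf-preserves : ∀ R b c v q → (T b → R v c) → AllCoords R q → AllCoords R (setIf b c v q)
setIf-preserves R false c v q new old c' = old c'
setIf-preserves R true  c v q new old c' with c' Fin.≟ c
... | yes refl = new _
... | no  _    = old c'

other-just : ∀ {n} (i k : Fin n) uv → other i uv ≡ just k →
  (proj₁ uv ≡ i × proj₂ uv ≡ k) ⊎ (proj₂ uv ≡ i × proj₁ uv ≡ k)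
other-just i k (u , v) h with u Fin.≟ i
other-just i k (u , v) refl | yes u≡i = inj₁ (u≡i , refl)
... | no _ with v Fin.≟ i
other-just i k (u , v) refl | no _ | yes v≡i = inj₂ (v≡i , refl)
other-just i k (u , v) ()   | no _ | no _

other-endpoints : ∀ {n} (i j k k' : Fin n) uv → i ≢ j →
  other i uv ≡ just k → other j uv ≡ just k' → k ≡ j
other-endpoints i j k k' uv i≢j hi hj with other-just i k uv hi | other-just j k' uv hj
... | inj₁ (u≡i , _)   | inj₁ (u≡j , _)   = ⊥-elim (i≢j (trans (sym u≡i) u≡j))
... | inj₁ (_ , v≡k)   | inj₂ (v≡j , _)   = trans (sym v≡k) v≡j
... | inj₂ (_ , u≡k)   | inj₁ (u≡j , _)   = trans (sym u≡k) u≡j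
... | inj₂ (v≡i , _)   | inj₂ (v≡j , _)   = ⊥-elim (i≢j (trans (sym v≡i) v≡j))

module RelaxedPosition (n m : ℕ) (p : Fin n → Point) (e : Fin m → Fin n × Fin n) where
  open Construction n m p e

  vertexValue : Fin n → ℕ
  vertexValue i = suc (toℕ i)

  edgeValue : Fin m → ℕ
  edgeValue j = n ℕ.+ suc (toℕ j)

  vertexValue-injective : ∀ i j → vertexValue i ≡ vertexValue j → i ≡ j
  vertexValue-injective i j eq = toℕ-injective (ℕP.suc-injective eq)

  edgeValue-injective : ∀ j j' → edgeValue j ≡ edgeValue j' → j ≡ j'
  edgeValue-injective j j' eq = toℕ-injective (ℕP.suc-injective (ℕP.+-cancelˡ-≡ n _ _ eq))

  -- Vertex labels are at most n, edge values exceed n.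
  vertexValue≢edgeValue : ∀ i j → vertexValue i ≢ edgeValue j
  vertexValue≢edgeValue i j = ℕP.<⇒≢ (ℕP.≤-<-trans (toℕ<n i) (ℕP.m<m+n n ℕ.z<s))

  updateBy-preserves : ∀ R i k l q →
    (∀ c → T (guard (p i) (p k) c) → R (n ℕ.+ l) c) →
    AllCoords R q → AllCoords R (updateBy i k l q)
  updateBy-preserves R i k l q new =
    foldl-preserves (AllCoords R)
      (λ q' c → setIf-preserves R (guard (p i) (p k) c) c (n ℕ.+ l) q' (new c))
      (allFin 4)

  Admissible : Fin n → ℕ → Fin 4 → Set
  Admissible i x c = x ≡ vertexValue i ⊎
    Σ[ j ∈ Fin m ] Σ[ k ∈ Fin n ] other i (e j) ≡ just k × x ≡ edgeValue j × p k ≡ partner c (p i)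

  step-preserves : ∀ i q' j → AllCoords (Admissible i) q' → AllCoords (Admissible i) (step i q' j)
  step-preserves i q' j inv with other i (e j) in endpoint
  ... | nothing = inv
  ... | just k  = updateBy-preserves (Admissible i) i k _ q'
                    (λ c g → inj₂ (j , k , endpoint , refl , guard-partner c _ _ g)) inv

  q-admissible : ∀ i → AllCoords (Admissible i) (q i)
  q-admissible i = foldl-preserves (AllCoords (Admissible i)) (step-preserves i) (allFin m) (λ _ → inj₁ refl)

  SharedVia : Fin n → Fin n → Fin 4 → Set
  SharedVia i j c = Σ[ t ∈ Fin m ] other i (e t) ≡ just j × q i c ≡ edgeValue t × p j ≡ partner c (p i)

  shared-coordinate : ∀ i j c → i ≢ j → q i c ≡ q j c → SharedVia i j c
  shared-coordinate i j c i≢j same with q-admissible i c | q-admissible j c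
  ... | inj₁ qi | inj₁ qj = ⊥-elim (i≢j (vertexValue-injective i j (trans (sym qi) (trans same qj))))
  ... | inj₁ qi | inj₂ (t , _ , _ , qj , _) = ⊥-elim (vertexValue≢edgeValue i t (trans (sym qi) (trans same qj)))
  ... | inj₂ (t , _ , _ , qi , _) | inj₁ qj = ⊥-elim (vertexValue≢edgeValue j t (trans (sym qj) (trans (sym same) qi)))
  ... | inj₂ (t , k , ei , qi , pk) | inj₂ (t' , k' , ej , qj , _)
    with edgeValue-injective t t' (trans (sym qi) (trans same qj))
  ... | refl with other-endpoints i j k k' (e t) i≢j ei ej
  ... | refl = t , ei , qi , pk

  no-three-share : ∀ i j k → i ≢ j → j ≢ k → i ≢ k → ∀ c → ¬ (q i c ≡ q j c × q j c ≡ q k c)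
  no-three-share i j k i≢j j≢k i≢k c (ij , jk)
    with shared-coordinate i j c i≢j ij | shared-coordinate i k c i≢k (trans ij jk)
  ... | t , ej , qt , _ | t' , ek , qt' , _ with edgeValue-injective t t' (trans (sym qt) qt')
  ... | refl = j≢k (just-injective (trans (sym ej) ek))

  -- Two distinct points share at most one coordinate: both shared
  -- coordinates c, c' would have p_j as partner of p_i.
  share-at-most-one : ∀ i j → i ≢ j → ∀ c c' → q i c ≡ q j c → q i c' ≡ q j c' → c ≡ c'
  share-at-most-one i j i≢j c c' same same'
    with shared-coordinate i j c i≢j same | shared-coordinate i j c' i≢j same'
  ... | _ , _ , _ , pj | _ , _ , _ , pj' = partner-injective (p i) c c' (trans (sym pj) pj')

lemma3p1 : (n m : ℕ) (p : Fin n → Point) (e : Fin m → Fin n × Fin n) →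
    Injective _≡_ _≡_ p →
    IsEdgeLabelling n m p e →
    RelaxedGeneralPosition (Construction.q n m p e)
lemma3p1 n m p e _ _ = no-three-share , share-at-most-one
  where open RelaxedPosition n m p e
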